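{- Let $T$ be a tree and $\mathcal{P}$ a set of non-trivial simple paths in $T$. If $C$ is a hole (induced cycle) of $\mathrm{EPT}(T,\mathcal{P})$ with at least $4$ vertices, then no edge of $C$ is an edge of $\mathrm{ENPT}(T,\mathcal{P})$.
   Context: Given a tree $T$ and a set $\mathcal{P}=\{P_v\}$ of non-trivial simple paths in $T$ (each with at least one edge): $\mathrm{EPT}(T,\mathcal{P})$ has a vertex $v$ for each path $P_v$, with $u,v$ adjacent iff $P_u,P_v$ share at least one edge of $T$. Two paths are non-splitting if they share at least one edge and no vertex has degree at least $3$ in their union (equivalently, their union is a path); $\mathrm{ENPT}(T,\mathcal{P})$ has the same vertex set, with $u,v$ adjacent iff $P_u,P_v$ are non-splitting. Thus $E(\mathrm{ENPT}(T,\mathcal{P}))\subseteq E(\mathrm{EPT}(T,\mathcal{P}))$. A hole is a cycle of a graph with no chords, i.e. an induced cycle. -}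

module Defs where

open import Data.Nat using (ℕ; zero; suc; _≤_)
open import Data.Fin using (Fin; toℕ)
open import Data.List using (List; []; _∷_; _++_; length; reverse)
open import Data.List.Relation.Unary.Unique.Propositional using (Unique)
open import Data.List.Relation.Unary.Linked using (Linked)
open import Data.Product using (Σ; ∃; _×_; _,_)
open import Data.Sum using (_⊎_)
open import Relation.Nullary using (¬_)
open import Relation.Binary.PropositionalEquality using (_≡_; _≢_)
open import Function.Definitions using (Injective)

data Walk {n : ℕ} (Adj : Fin n → Fin n → Set) : Fin n → Fin n → Set where
  stop : ∀ {u} → Walk Adj u u
  step : ∀ {u w v} → Adj u w → Walk Adj w v → Walk Adj u v

HasCycle : {n : ℕ} → (Fin n → Fin n → Set) → Set
HasCycle {n} Adj =
  Σ (Fin n) λ x → Σ (List (Fin n)) λ ys →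
    (2 ≤ length ys) × Unique (x ∷ ys) × Linked Adj (x ∷ ys ++ x ∷ [])

record Tree (n : ℕ) : Set₁ where
  field
    Adj       : Fin n → Fin n → Set
    sym       : ∀ {u v} → Adj u v → Adj v u
    irrefl    : ∀ {u} → ¬ Adj u u
    connected : ∀ u v → Walk Adj u v
    acyclic   : ¬ HasCycle Adj

NontrivialPath : {n : ℕ} → Tree n → List (Fin n) → Set
NontrivialPath T vs = (2 ≤ length vs) × Unique vs × Linked (Tree.Adj T) vs

data Consecutive {A : Set} : List A → A → A → Set where
  here  : ∀ {x y xs} → Consecutive (x ∷ y ∷ xs) x y
  there : ∀ {x xs a b} → Consecutive xs a b → Consecutive (x ∷ xs) a b

PathEdge : {n : ℕ} → List (Fin n) → Fin n → Fin n → Set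
PathEdge p a b = Consecutive p a b ⊎ Consecutive p b a

ShareEdge : {n : ℕ} → List (Fin n) → List (Fin n) → Set
ShareEdge {n} p q =
  Σ (Fin n) λ a → Σ (Fin n) λ b → PathEdge p a b × PathEdge q a b

UnionAdj : {n : ℕ} → List (Fin n) → List (Fin n) → Fin n → Fin n → Set
UnionAdj p q v w = PathEdge p v w ⊎ PathEdge q v w

UnionHasDeg3 : {n : ℕ} → List (Fin n) → List (Fin n) → Set
UnionHasDeg3 {n} p q =
  Σ (Fin n) λ v → Σ (Fin n) λ w₁ → Σ (Fin n) λ w₂ → Σ (Fin n) λ w₃ →
    (w₁ ≢ w₂) × (w₁ ≢ w₃) × (w₂ ≢ w₃) ×
    UnionAdj p q v w₁ × UnionAdj p q v w₂ × UnionAdj p q v w₃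

NonSplitting : {n : ℕ} → List (Fin n) → List (Fin n) → Set
NonSplitting p q = ShareEdge p q × ¬ UnionHasDeg3 p q

SamePath : {n : ℕ} → List (Fin n) → List (Fin n) → Set
SamePath p q = p ≡ q ⊎ p ≡ reverse q

EPTAdj : {n m : ℕ} → (Fin m → List (Fin n)) → Fin m → Fin m → Set
EPTAdj P i j = (i ≢ j) × ShareEdge (P i) (P j)

ENPTAdj : {n m : ℕ} → (Fin m → List (Fin n)) → Fin m → Fin m → Set
ENPTAdj P i j = (i ≢ j) × NonSplitting (P i) (P j)

CycSucc : (k : ℕ) → Fin k → Fin k → Set
CycSucc k i j = (suc (toℕ i) ≡ toℕ j) ⊎ ((suc (toℕ i) ≡ k) × (toℕ j ≡ 0))

IsHole : {m : ℕ} → (Fin m → Fin m → Set) → (k : ℕ) → (Fin k → Fin m) → Set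
IsHole Adj k c =
  Injective _≡_ _≡_ c ×
  (∀ i j → CycSucc k i j → Adj (c i) (c j)) ×
  (∀ i j → Adj (c i) (c j) → CycSucc k i j ⊎ CycSucc k j i)

-- Let i → j be an edge of the hole and suppose P_i and P_j are non-splitting.
-- The predecessor p of i shares an edge with P_i which P_j does not contain,
-- for otherwise p would be a common neighbour of i and j, i.e. a chord. Going
-- along P_i from that edge towards an edge shared with P_j, one finds
-- consecutive edges uv ∉ P_j and vw ∈ P_i ∩ P_j; as the union of P_i and P_j
-- has no vertex of degree 3, vw is the only edge of P_j at v. No other path of
-- the hole contains vw (again there are no chords), so walking backwards round
-- the hole from p to the successor s of j, consecutive paths share a vertex
-- and every path stays in the component of v in T − vw. But P_s shares an edge
-- with P_j, all of whose vertices except v lie in the component of w, and the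
-- edge vw of a tree is a bridge.

module Submission where

open import Data.Empty using (⊥-elim)
open import Data.Fin using (Fin; zero; suc; toℕ; fromℕ; fromℕ<; inject₁)
open import Data.Fin.Properties using (_≟_; toℕ-injective; toℕ-fromℕ; toℕ-fromℕ<; toℕ-inject₁; toℕ<n)
open import Data.List using (List; []; _∷_; _++_)
open import Data.List.Membership.Propositional using (_∈_; _∉_)
open import Data.List.Relation.Unary.All using ([])
open import Data.List.Relation.Unary.All.Properties using (¬Any⇒All¬)
open import Data.List.Relation.Unary.Any using (here; there; any?)
open import Data.List.Relation.Unary.AllPairs as AllPairs using ([]; _∷_)
open import Data.List.Relation.Unary.Linked as Linked using (Linked; []; [-]; _∷_)
open import Data.List.Relation.Unary.Unique.Propositional using (Unique)
open import Data.List.Relation.Unary.Unique.Propositional.Properties using (Unique[x∷xs]⇒x∉xs)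
open import Data.Nat using (ℕ; zero; suc; _≤_; _<_; z≤n; s≤s; _≤′_; ≤′-refl; ≤′-step)
open import Data.Nat.Properties
  using (≤-refl; <⇒≤; <-irrefl; <⇒≢; >⇒≢; ≤⇒≤′; ≤′⇒≤; z≤′n; 1+n≢n; suc-injective; n<1+n; m<n⇒m<1+n)
open import Data.Product as Product using (∃; _×_; _,_; proj₁; proj₂)
open import Data.Sum as Sum using (_⊎_; inj₁; inj₂; swap)
open import Function using (_∘_)
open import Relation.Nullary using (¬_; yes; no; Dec; contradiction)
open import Relation.Binary.PropositionalEquality using (_≡_; _≢_; refl; sym; trans; cong; subst)
open import Defs

module _ {n : ℕ} {R : Fin n → Fin n → Set} where

  infixr 5 _◅◅_
  _◅◅_ : ∀ {x y z} → Walk R x y → Walk R y z → Walk R x z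
  stop     ◅◅ q = q
  step r p ◅◅ q = step r (p ◅◅ q)

  reverseWalk : (∀ {a b} → R a b → R b a) → ∀ {x y} → Walk R x y → Walk R y x
  reverseWalk R-sym stop       = stop
  reverseWalk R-sym (step r p) = reverseWalk R-sym p ◅◅ step (R-sym r) stop

  walkFromHead : ∀ {x y xs} → Linked R (x ∷ xs) → y ∈ x ∷ xs → Walk R x y
  walkFromHead _        (here refl) = stop
  walkFromHead (r ∷ rs) (there y∈)  = step r (walkFromHead rs y∈)

  walkWithin : (∀ {a b} → R a b → R b a) → ∀ {xs x y} → Linked R xs → x ∈ xs → y ∈ xs → Walk R x y
  walkWithin R-sym {_ ∷ _} rs x∈ y∈ = reverseWalk R-sym (walkFromHead rs x∈) ◅◅ walkFromHead rs y∈

  lastOf : Fin n → List (Fin n) → Fin n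
  lastOf x []       = x
  lastOf _ (y ∷ ys) = lastOf y ys

  linked-snoc : ∀ {x y} ys → Linked R (x ∷ ys) → R (lastOf x ys) y → Linked R (x ∷ ys ++ y ∷ [])
  linked-snoc []       _        r = r ∷ [-]
  linked-snoc (_ ∷ ys) (r ∷ rs) r′ = r ∷ linked-snoc ys rs r′

  record SimpleWalk (x y : Fin n) : Set where
    field
      rest   : List (Fin n)
      linked : Linked R (x ∷ rest)
      unique : Unique (x ∷ rest)
      ends   : lastOf x rest ≡ y

  simpleSuffix : ∀ {x} y ys → x ∈ y ∷ ys → Linked R (y ∷ ys) → Unique (y ∷ ys) → SimpleWalk x (lastOf y ys)
  simpleSuffix y ys (here refl) rs u =
    record { rest = ys ; linked = rs ; unique = u ; ends = refl }
  simpleSuffix y (y′ ∷ ys) (there x∈) (_ ∷ rs) (_ ∷ u) = simpleSuffix y′ ys x∈ rs u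

  eraseLoops : ∀ {x y} → Walk R x y → SimpleWalk x y
  eraseLoops stop = record { rest = [] ; linked = [-] ; unique = [] ∷ [] ; ends = refl }
  eraseLoops {x} (step {w = z} r p) with eraseLoops p
  ... | record { rest = zs ; linked = rs ; unique = u ; ends = e } with any? (x ≟_) (z ∷ zs)
  ...   | yes x∈ = subst (SimpleWalk x) e (simpleSuffix z zs x∈ rs u)
  ...   | no x∉  = record { rest = z ∷ zs ; linked = r ∷ rs ; unique = ¬Any⇒All¬ _ x∉ ∷ u ; ends = e }

SameEdge : ∀ {n} → Fin n → Fin n → Fin n → Fin n → Set
SameEdge a b v w = (a ≡ v × b ≡ w) ⊎ (a ≡ w × b ≡ v)

module _ {n : ℕ} where

  SameEdge-sym : ∀ {a b v w : Fin n} → SameEdge a b v w → SameEdge b a v w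
  SameEdge-sym (inj₁ (a≡v , b≡w)) = inj₂ (b≡w , a≡v)
  SameEdge-sym (inj₂ (a≡w , b≡v)) = inj₁ (b≡v , a≡w)

  consecutive-∈ : ∀ {xs : List (Fin n)} {a b} → Consecutive xs a b → a ∈ xs × b ∈ xs
  consecutive-∈ here       = here refl , there (here refl)
  consecutive-∈ (there ab) = Product.map there there (consecutive-∈ ab)

  pathEdge-∈ : ∀ {xs : List (Fin n)} {a b} → PathEdge xs a b → a ∈ xs × b ∈ xs
  pathEdge-∈ (inj₁ ab) = consecutive-∈ ab
  pathEdge-∈ (inj₂ ba) = Product.swap (consecutive-∈ ba)

  ∉⇒¬pathEdge : ∀ {xs : List (Fin n)} {v w} → v ∉ xs → ¬ PathEdge xs v w
  ∉⇒¬pathEdge v∉ = v∉ ∘ proj₁ ∘ pathEdge-∈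

  sameEdge⇒pathEdge : ∀ {xs : List (Fin n)} {a b v w} → SameEdge a b v w → PathEdge (a ∷ b ∷ xs) v w
  sameEdge⇒pathEdge (inj₁ (refl , refl)) = inj₁ here
  sameEdge⇒pathEdge (inj₂ (refl , refl)) = inj₂ here

  sameEdge-pathEdge : ∀ {xs : List (Fin n)} {a b v w} → SameEdge a b v w → PathEdge xs v w → PathEdge xs a b
  sameEdge-pathEdge (inj₁ (refl , refl)) vw = vw
  sameEdge-pathEdge (inj₂ (refl , refl)) vw = swap vw

  pathEdge-∷⁻ : ∀ {x y a b : Fin n} {xs} → PathEdge (x ∷ y ∷ xs) a b → SameEdge a b x y ⊎ PathEdge (y ∷ xs) a b
  pathEdge-∷⁻ (inj₁ here)        = inj₁ (inj₁ (refl , refl))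
  pathEdge-∷⁻ (inj₂ here)        = inj₁ (inj₂ (refl , refl))
  pathEdge-∷⁻ (inj₁ (there ab))  = inj₂ (inj₁ ab)
  pathEdge-∷⁻ (inj₂ (there ba))  = inj₂ (inj₂ ba)

  consecutive? : (xs : List (Fin n)) (a b : Fin n) → Dec (Consecutive xs a b)
  consecutive? []           a b = no λ ()
  consecutive? (x ∷ [])     a b = no λ { (there ()) }
  consecutive? (x ∷ y ∷ xs) a b with x ≟ a | y ≟ b | consecutive? (y ∷ xs) a b
  ... | yes refl | yes refl | _       = yes here
  ... | _        | _        | yes ab  = yes (there ab)
  ... | no x≢a   | _        | no ¬ab  = no λ { here → x≢a refl ; (there ab) → ¬ab ab }
  ... | yes _    | no y≢b   | no ¬ab  = no λ { here → y≢b refl ; (there ab) → ¬ab ab }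

  pathEdge? : (xs : List (Fin n)) (a b : Fin n) → Dec (PathEdge xs a b)
  pathEdge? xs a b with consecutive? xs a b | consecutive? xs b a
  ... | yes ab | _      = yes (inj₁ ab)
  ... | no _   | yes ba = yes (inj₂ ba)
  ... | no ¬ab | no ¬ba = no λ { (inj₁ ab) → ¬ab ab ; (inj₂ ba) → ¬ba ba }

sole-edge-at-departure : ∀ {n} {A B : List (Fin n)} {u v w z} → ¬ UnionHasDeg3 A B →
                         PathEdge A u v → ¬ PathEdge B u v → PathEdge B v w → PathEdge B v z → z ≡ w
sole-edge-at-departure {u = u} {v} {w} {z} no-deg3 uv∈A uv∉B vw∈B vz∈B with z ≟ w
... | yes z≡w = z≡w
... | no z≢w  =
  contradiction (v , u , w , z , u≢w , u≢z , z≢w ∘ sym , inj₁ (swap uv∈A) , inj₂ vw∈B , inj₂ vz∈B) no-deg3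
  where
  u≢w : u ≢ w
  u≢w refl = uv∉B (swap vw∈B)
  u≢z : u ≢ z
  u≢z refl = uv∉B (swap vz∈B)

module TreePaths {n : ℕ} (T : Tree n) where
  open Tree T renaming (sym to Adj-sym)

  Avoiding : Fin n → Fin n → Fin n → Fin n → Set
  Avoiding v w a b = Adj a b × ¬ SameEdge a b v w

  Avoiding-sym : ∀ {v w a b} → Avoiding v w a b → Avoiding v w b a
  Avoiding-sym (ab , ab≠vw) = Adj-sym ab , ab≠vw ∘ SameEdge-sym

  -- Loop-erased and closed up by the edge w v, such a walk would be a cycle.
  edge-is-bridge : ∀ {v w} → Adj v w → ¬ Walk (Avoiding v w) v w
  edge-is-bridge {v} vw W with eraseLoops W
  ... | record { rest = [] ; ends = refl } = irrefl vw
  ... | record { rest = _ ∷ [] ; linked = (_ , ¬vw) ∷ [-] ; ends = refl } = ¬vw (inj₁ (refl , refl))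
  ... | record { rest = y ∷ z ∷ ys ; linked = rs ; unique = u ; ends = e } =
    acyclic (v , y ∷ z ∷ ys , s≤s (s≤s z≤n) , u ,
             linked-snoc (y ∷ z ∷ ys) (Linked.map proj₁ rs) (subst (λ x → Adj x v) (sym e) (Adj-sym vw)))

  pathEdge-adj : ∀ {xs a b} → Linked Adj xs → PathEdge xs a b → Adj a b
  pathEdge-adj rs (inj₁ ab) = consecutive-adj rs ab
    where
    consecutive-adj : ∀ {xs a b} → Linked Adj xs → Consecutive xs a b → Adj a b
    consecutive-adj (r ∷ _)  here       = r
    consecutive-adj (_ ∷ rs) (there ab) = consecutive-adj rs ab
  pathEdge-adj rs (inj₂ ba) = Adj-sym (pathEdge-adj rs (inj₁ ba))

  linked-avoiding : ∀ {xs v w} → Linked Adj xs → ¬ PathEdge xs v w → Linked (Avoiding v w) xs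
  linked-avoiding []        _   = []
  linked-avoiding [-]       _   = [-]
  linked-avoiding (ab ∷ rs) vw∉ =
    (ab , vw∉ ∘ sameEdge⇒pathEdge) ∷ linked-avoiding rs (vw∉ ∘ Sum.map there there)

  walkAvoiding : ∀ {xs v w x y} → Linked Adj xs → ¬ PathEdge xs v w → x ∈ xs → y ∈ xs → Walk (Avoiding v w) x y
  walkAvoiding rs vw∉ = walkWithin Avoiding-sym (linked-avoiding rs vw∉)

  avoids-head : ∀ {x y xs v w} → Unique (x ∷ xs) → Adj x y → PathEdge xs v w → Avoiding v w x y
  avoids-head u xy vw∈xs = xy , Unique[x∷xs]⇒x∉xs u ∘ proj₁ ∘ pathEdge-∈ ∘ λ same → sameEdge-pathEdge same vw∈xs

  -- Along A, the edge uv leaves B at v while vw is still shared, and x lies on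
  -- the part of A before v.
  record Departure (A B : List (Fin n)) (x : Fin n) : Set where
    field
      {u v w} : Fin n
      uv∈A : PathEdge A u v
      vw∈A : PathEdge A v w
      uv∉B : ¬ PathEdge B u v
      vw∈B : PathEdge B v w
      x↝v  : Walk (Avoiding v w) x v

  module _ {B : List (Fin n)} where

    departure-∷ : ∀ {x y A} → Departure A B x → Departure (y ∷ A) B x
    departure-∷ d = record { uv∈A = Sum.map there there uv∈A ; vw∈A = Sum.map there there vw∈A
                           ; uv∉B = uv∉B ; vw∈B = vw∈B ; x↝v = x↝v }
      where open Departure d

    departure-forward : ∀ {x y xs a b} → Unique (x ∷ y ∷ xs) → Linked Adj (x ∷ y ∷ xs) → ¬ PathEdge B x y →
                        Consecutive (x ∷ y ∷ xs) a b → PathEdge B a b → Departure (x ∷ y ∷ xs) B x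
    departure-forward _ _ xy∉B here ab∈B = contradiction ab∈B xy∉B
    departure-forward {xs = []} _ _ _ (there (there ())) _
    departure-forward {y = y} {z ∷ xs} uniq (xy ∷ rs) xy∉B (there ab) ab∈B with pathEdge? B y z
    ... | yes yz∈B = record { uv∈A = inj₁ here ; vw∈A = inj₁ (there here) ; uv∉B = xy∉B ; vw∈B = yz∈B
                            ; x↝v = step (avoids-head uniq xy (inj₁ here)) stop }
    ... | no yz∉B  = record { uv∈A = Sum.map there there uv∈A ; vw∈A = Sum.map there there vw∈A
                            ; uv∉B = uv∉B ; vw∈B = vw∈B ; x↝v = step (avoids-head uniq xy vw∈A) x↝v }
      where open Departure (departure-forward (AllPairs.tail uniq) rs yz∉B ab ab∈B)

    departure-backward : ∀ {x y xs a b} → Unique (x ∷ y ∷ xs) → Linked Adj (x ∷ y ∷ xs) → PathEdge B x y →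
                         Consecutive (x ∷ y ∷ xs) a b → ¬ PathEdge B a b → Departure (x ∷ y ∷ xs) B a
    departure-backward _ _ xy∈B here ab∉B = contradiction xy∈B ab∉B
    departure-backward {xs = []} _ _ _ (there (there ())) _
    departure-backward {y = y} {z ∷ xs} uniq (_ ∷ rs) xy∈B (there ab) ab∉B with pathEdge? B y z
    ... | yes yz∈B = departure-∷ (departure-backward (AllPairs.tail uniq) rs yz∈B ab ab∉B)
    ... | no yz∉B  = record { uv∈A = inj₂ (there here) ; vw∈A = inj₂ here ; uv∉B = yz∉B ∘ swap ; vw∈B = swap xy∈B
                            ; x↝v = walkAvoiding rs (∉⇒¬pathEdge (Unique[x∷xs]⇒x∉xs uniq) ∘ swap)
                                                 (proj₁ (consecutive-∈ ab)) (here refl) }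

    departure : ∀ {A x y a b} → Unique A → Linked Adj A → Consecutive A x y → ¬ PathEdge B x y →
                Consecutive A a b → PathEdge B a b → Departure A B x
    departure uniq rs here        xy∉B ab        ab∈B = departure-forward uniq rs xy∉B ab ab∈B
    departure uniq rs (there xy)  xy∉B here      ab∈B = departure-backward uniq rs ab∈B (there xy) xy∉B
    departure (_ ∷ uniq) (_ ∷ rs) (there xy) xy∉B (there ab) ab∈B = departure-∷ (departure uniq rs xy xy∉B ab ab∈B)

    departure-shared : ∀ {A x y} → Unique A → Linked Adj A → Consecutive A x y → ¬ PathEdge B x y →
                       ShareEdge A B → Departure A B x
    departure-shared uniq rs xy xy∉B (_ , _ , inj₁ ab , ab∈B) = departure uniq rs xy xy∉B ab ab∈B
    departure-shared uniq rs xy xy∉B (_ , _ , inj₂ ba , ab∈B) = departure uniq rs xy xy∉B ba (swap ab∈B)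

    departure-from : ∀ {A x y} → Unique A → Linked Adj A → PathEdge A x y → ¬ PathEdge B x y → ShareEdge A B →
                     Departure A B x
    departure-from uniq rs (inj₁ xy) xy∉B shared = departure-shared uniq rs xy xy∉B shared
    departure-from uniq rs xy@(inj₂ yx) xy∉B shared = record
      { uv∈A = uv∈A ; vw∈A = vw∈A ; uv∉B = uv∉B ; vw∈B = vw∈B
      ; x↝v = step (pathEdge-adj rs xy , xy∉B ∘ λ same → sameEdge-pathEdge same vw∈B) x↝v }
      where open Departure (departure-shared uniq rs yx (xy∉B ∘ swap) shared)

  far-side-of-endpoint : ∀ {B v w x} → Unique B → Linked Adj B → PathEdge B v w →
                         (∀ {z} → PathEdge B v z → z ≡ w) → x ∈ B → x ≡ v ⊎ Walk (Avoiding v w) x w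
  far-side-of-endpoint {_ ∷ []} _ _ (inj₁ (there ())) _ _
  far-side-of-endpoint {_ ∷ []} _ _ (inj₂ (there ())) _ _
  far-side-of-endpoint {_ ∷ _ ∷ _} uniq rs vw only-w x∈ with pathEdge-∷⁻ vw
  far-side-of-endpoint uniq rs vw only-w (here refl) | inj₁ (inj₁ (refl , refl)) = inj₁ refl
  far-side-of-endpoint uniq (_ ∷ rs) vw only-w (there x∈) | inj₁ (inj₁ (refl , refl)) =
    inj₂ (walkAvoiding rs (∉⇒¬pathEdge (Unique[x∷xs]⇒x∉xs uniq)) x∈ (here refl))
  far-side-of-endpoint {_ ∷ _ ∷ []} uniq rs vw only-w (here refl) | inj₁ (inj₂ (refl , refl)) = inj₂ stop
  far-side-of-endpoint {_ ∷ _ ∷ []} uniq rs vw only-w (there (here refl)) | inj₁ (inj₂ (refl , refl)) = inj₁ refl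
  far-side-of-endpoint {_ ∷ _ ∷ _ ∷ _} uniq rs vw only-w x∈ | inj₁ (inj₂ (refl , refl)) =
    contradiction (there (here (sym (only-w (inj₁ (there here)))))) (Unique[x∷xs]⇒x∉xs uniq)
  far-side-of-endpoint uniq (x₀x₁ ∷ rs) vw only-w (here refl) | inj₂ vw∈tail
    with far-side-of-endpoint (AllPairs.tail uniq) rs vw∈tail (only-w ∘ Sum.map there there) (here refl)
  ... | inj₁ refl =
    contradiction (subst (_∈ _) (sym (only-w (inj₂ here))) (proj₂ (pathEdge-∈ vw∈tail))) (Unique[x∷xs]⇒x∉xs uniq)
  ... | inj₂ x₁↝w = inj₂ (step (avoids-head uniq x₀x₁ vw∈tail) x₁↝w)
  far-side-of-endpoint uniq (_ ∷ rs) vw only-w (there x∈) | inj₂ vw∈tail =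
    far-side-of-endpoint (AllPairs.tail uniq) rs vw∈tail (only-w ∘ Sum.map there there) x∈

  OnSide : Fin n → Fin n → List (Fin n) → Set
  OnSide v w xs = ∀ {x} → x ∈ xs → Walk (Avoiding v w) x v

  onSide : ∀ {xs v w x} → Linked Adj xs → ¬ PathEdge xs v w → x ∈ xs → Walk (Avoiding v w) x v → OnSide v w xs
  onSide rs vw∉ x∈ x↝v y∈ = walkAvoiding rs vw∉ y∈ x∈ ◅◅ x↝v

  not-on-both-sides : ∀ {v w x} → Adj v w → Walk (Avoiding v w) x v → ¬ Walk (Avoiding v w) x w
  not-on-both-sides vw x↝v x↝w = edge-is-bridge vw (reverseWalk Avoiding-sym x↝v ◅◅ x↝w)

  no-shared-edge-behind-end : ∀ {B xs v w} → Unique B → Linked Adj B → PathEdge B v w →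
                              (∀ {z} → PathEdge B v z → z ≡ w) → OnSide v w xs → ¬ ShareEdge B xs
  no-shared-edge-behind-end uniq rs vw∈B only-w xs-side (a , b , ab∈B , ab∈xs)
    with far-side-of-endpoint uniq rs vw∈B only-w (proj₁ (pathEdge-∈ ab∈B))
       | far-side-of-endpoint uniq rs vw∈B only-w (proj₂ (pathEdge-∈ ab∈B))
  ... | inj₁ refl | inj₁ refl = irrefl (pathEdge-adj rs ab∈B)
  ... | inj₂ a↝w  | _         = not-on-both-sides (pathEdge-adj rs vw∈B) (xs-side (proj₁ (pathEdge-∈ ab∈xs))) a↝w
  ... | _         | inj₂ b↝w  = not-on-both-sides (pathEdge-adj rs vw∈B) (xs-side (proj₂ (pathEdge-∈ ab∈xs))) b↝w

-- CycSucc k i j unfolds to CycStep k (toℕ i) (toℕ j); stated on ℕ, the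
-- positions can be matched against refl.
CycStep : ℕ → ℕ → ℕ → Set
CycStep k a b = suc a ≡ b ⊎ (suc a ≡ k × b ≡ 0)

CycStep-functional : ∀ {k a b b′} → b < k → b′ < k → CycStep k a b → CycStep k a b′ → b ≡ b′
CycStep-functional _   _    (inj₁ refl)       (inj₁ refl)       = refl
CycStep-functional b<k _    (inj₁ refl)       (inj₂ (refl , _)) = ⊥-elim (<-irrefl refl b<k)
CycStep-functional _   b<k  (inj₂ (refl , _)) (inj₁ refl)       = ⊥-elim (<-irrefl refl b<k)
CycStep-functional _   _    (inj₂ (_ , refl)) (inj₂ (_ , refl)) = refl

CycStep-injective : ∀ {k a a′ b} → CycStep k a b → CycStep k a′ b → a ≡ a′
CycStep-injective (inj₁ refl)       (inj₁ e)          = suc-injective (sym e)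
CycStep-injective (inj₂ (e , _))    (inj₂ (f , _))    = suc-injective (trans e (sym f))
CycStep-injective (inj₁ refl)       (inj₂ (_ , ()))
CycStep-injective (inj₂ (_ , refl)) (inj₁ ())

CycStep-irreflexive : ∀ {k a} → 2 ≤ k → ¬ CycStep k a a
CycStep-irreflexive _                (inj₁ e)          = 1+n≢n e
CycStep-irreflexive (s≤s (s≤s _))    (inj₂ (() , refl))

CycStep-asymmetric : ∀ {k a b} → 3 ≤ k → CycStep k a b → ¬ CycStep k b a
CycStep-asymmetric _                   (inj₁ refl)       (inj₁ e)          = >⇒≢ (m<n⇒m<1+n (n<1+n _)) e
CycStep-asymmetric (s≤s (s≤s (s≤s _))) (inj₁ refl)       (inj₂ (() , refl))
CycStep-asymmetric (s≤s (s≤s (s≤s _))) (inj₂ (() , refl)) (inj₁ refl)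
CycStep-asymmetric (s≤s (s≤s (s≤s _))) (inj₂ (_ , refl)) (inj₂ (() , refl))

CycStep-no-triangle : ∀ {k a b c} → 4 ≤ k → CycStep k a b → CycStep k b c → ¬ CycStep k c a
CycStep-no-triangle _ (inj₁ refl) (inj₁ refl) (inj₁ e) = >⇒≢ (m<n⇒m<1+n (m<n⇒m<1+n (n<1+n _))) e
CycStep-no-triangle (s≤s (s≤s (s≤s (s≤s _)))) (inj₁ refl) (inj₁ refl) (inj₂ (() , refl))
CycStep-no-triangle (s≤s (s≤s (s≤s (s≤s _)))) (inj₁ refl) (inj₂ (() , refl)) (inj₁ refl)
CycStep-no-triangle (s≤s (s≤s (s≤s (s≤s _)))) (inj₂ (() , refl)) (inj₁ refl) (inj₁ refl)
CycStep-no-triangle (s≤s (s≤s _)) (inj₂ (refl , refl)) (inj₂ (() , refl)) _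

CycAdj : (k : ℕ) → Fin k → Fin k → Set
CycAdj k a b = CycSucc k a b ⊎ CycSucc k b a

cycPredecessor : ∀ {k} (i : Fin k) → ∃ λ p → CycSucc k p i
cycPredecessor {suc k} zero    = fromℕ k , inj₂ (cong suc (toℕ-fromℕ k) , refl)
cycPredecessor {suc k} (suc i) = inject₁ i , inj₁ (cong suc (toℕ-inject₁ i))

cycSuccessor : ∀ {k} (i : Fin k) → ∃ λ s → CycSucc k i s
cycSuccessor {suc zero}    zero    = zero , inj₂ (refl , refl)
cycSuccessor {suc (suc k)} zero    = suc zero , inj₁ refl
cycSuccessor {suc (suc k)} (suc i) with cycSuccessor i
... | s , inj₁ e       = suc s , inj₁ (cong suc e)
... | _ , inj₂ (e , _) = zero , inj₂ (cong suc e , refl)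

cycSucc-functional : ∀ {k} {i j j′ : Fin k} → CycSucc k i j → CycSucc k i j′ → j ≡ j′
cycSucc-functional {j = j} {j′} i→j i→j′ = toℕ-injective (CycStep-functional (toℕ<n j) (toℕ<n j′) i→j i→j′)

cycSucc-injective : ∀ {k} {i i′ j : Fin k} → CycSucc k i j → CycSucc k i′ j → i ≡ i′
cycSucc-injective i→j i′→j = toℕ-injective (CycStep-injective i→j i′→j)

no-common-neighbour : ∀ {k} {i j l : Fin k} → 4 ≤ k → CycSucc k i j → CycAdj k l i → ¬ CycAdj k l j
no-common-neighbour {k} {i} 4≤k i→j (inj₁ l→i) (inj₁ l→j) =
  CycStep-irreflexive (<⇒≤ (<⇒≤ 4≤k)) (subst (CycSucc k i) (sym (cycSucc-functional l→i l→j)) i→j)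
no-common-neighbour {k} {j = j} 4≤k i→j (inj₂ i→l) (inj₁ l→j) =
  CycStep-irreflexive (<⇒≤ (<⇒≤ 4≤k)) (subst (λ l → CycSucc k l j) (cycSucc-functional i→l i→j) l→j)
no-common-neighbour 4≤k i→j (inj₁ l→i) (inj₂ j→l) = CycStep-no-triangle 4≤k i→j j→l l→i
no-common-neighbour {k} {i} 4≤k i→j (inj₂ i→l) (inj₂ j→l) =
  CycStep-irreflexive (<⇒≤ (<⇒≤ 4≤k)) (subst (CycSucc k i) (sym (cycSucc-injective i→l j→l)) i→j)

_holdsAt_ : ∀ {k} → (Fin k → Set) → ℕ → Set
G holdsAt t = ∀ l → toℕ l ≡ t → G l

module ArcDescent {k : ℕ} {G : Fin k → Set} {i j : ℕ}
                    (pass : ∀ {l l′} → CycSucc k l′ l → toℕ l′ ≢ i → toℕ l′ ≢ j → G l → G l′) where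

  Free : ℕ → Set
  Free t = t ≢ i × t ≢ j

  descend-step : ∀ {t} → suc t < k → Free t → G holdsAt suc t → G holdsAt t
  descend-step t+1<k (t≢i , t≢j) g l refl =
    pass (inj₁ (sym (toℕ-fromℕ< t+1<k))) t≢i t≢j (g _ (toℕ-fromℕ< t+1<k))

  wrap-around : ∀ {t} → suc t ≡ k → Free t → G holdsAt 0 → G holdsAt t
  wrap-around t+1≡k (t≢i , t≢j) g l refl =
    pass (inj₂ (t+1≡k , toℕ-fromℕ< 0<k)) t≢i t≢j (g _ (toℕ-fromℕ< 0<k))
    where
    0<k : 0 < k
    0<k = subst (0 <_) t+1≡k (s≤s z≤n)

  descend : ∀ {a b} → a ≤′ b → b < k → (∀ {t} → a ≤ t → t < b → Free t) → G holdsAt b → G holdsAt a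
  descend ≤′-refl          _   _    g = g
  descend (≤′-step a≤′b) b<k free g =
    descend a≤′b (<⇒≤ b<k) (λ a≤t t<b → free a≤t (m<n⇒m<1+n t<b)) (descend-step b<k (free (≤′⇒≤ a≤′b) ≤-refl) g)

-- Descend from position p to position s, wrapping from 0 to k − 1 if the arc
-- p, …, s passes through 0.
arc-positions : ∀ {k} {G : Fin k → Set} {i j} →
                (∀ {l l′} → CycSucc k l′ l → toℕ l′ ≢ i → toℕ l′ ≢ j → G l → G l′) → 3 ≤ k →
                ∀ {p s} → p < k → s < k →
                CycStep k p i → CycStep k i j → CycStep k j s → G holdsAt p → G holdsAt s
arc-positions pass (s≤s (s≤s 1≤p)) p<k _ (inj₁ refl) (inj₂ (refl , refl)) (inj₁ refl) =
  descend (≤⇒≤′ 1≤p) p<k (λ 1≤t t<p → <⇒≢ (m<n⇒m<1+n t<p) , >⇒≢ 1≤t)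
  where open ArcDescent pass
arc-positions _ (s≤s (s≤s (s≤s _))) _ _ (inj₂ (refl , refl)) (inj₂ (() , _)) _
arc-positions _ (s≤s (s≤s (s≤s _))) _ _ _ (inj₂ (refl , refl)) (inj₂ (() , _))
arc-positions pass _ p<k (s≤s s≤K) (inj₁ refl) (inj₁ refl) (inj₁ refl) =
  descend (≤⇒≤′ s≤K) ≤-refl (λ s≤t _ → >⇒≢ (<⇒≤ s≤t) , >⇒≢ s≤t)
  ∘ wrap-around refl (>⇒≢ (<⇒≤ s≤K) , >⇒≢ s≤K)
  ∘ descend z≤′n p<k (λ _ t<p → <⇒≢ (m<n⇒m<1+n t<p) , <⇒≢ (m<n⇒m<1+n (m<n⇒m<1+n t<p)))
  where open ArcDescent pass
arc-positions pass _ p<k _ (inj₁ refl) (inj₁ refl) (inj₂ (refl , refl)) =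
  descend z≤′n p<k (λ _ t<p → <⇒≢ (m<n⇒m<1+n t<p) , <⇒≢ (m<n⇒m<1+n (m<n⇒m<1+n t<p)))
  where open ArcDescent pass
arc-positions pass (s≤s 2≤p) p<k _ (inj₂ (refl , refl)) (inj₁ refl) (inj₁ refl) =
  descend (≤⇒≤′ 2≤p) p<k (λ 2≤t _ → >⇒≢ (<⇒≤ 2≤t) , >⇒≢ 2≤t)
  where open ArcDescent pass
arc-positions _ (s≤s (s≤s (s≤s _))) _ _ (inj₂ (refl , refl)) (inj₁ refl) (inj₂ (() , _))

cycle-arc : ∀ {k} {G : Fin k → Set} {p i j s : Fin k} → 3 ≤ k →
            (∀ {l l′} → CycSucc k l′ l → l′ ≢ i → l′ ≢ j → G l → G l′) →
            CycSucc k p i → CycSucc k i j → CycSucc k j s → G p → G s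
cycle-arc {G = G} {p} {s = s} 3≤k pass p→i i→j j→s Gp =
  arc-positions (λ l′→l l′≢i l′≢j → pass l′→l (l′≢i ∘ cong toℕ) (l′≢j ∘ cong toℕ))
                3≤k (toℕ<n p) (toℕ<n s) p→i i→j j→s
                (λ l l≡p → subst G (sym (toℕ-injective l≡p)) Gp) s refl

module _ {n m : ℕ} (T : Tree n) (P : Fin m → List (Fin n)) (paths : ∀ i → NontrivialPath T (P i))
         {k : ℕ} (4≤k : 4 ≤ k) {c : Fin k → Fin m} (hole : IsHole (EPTAdj P) k c) where
  open Tree T using (Adj)
  open TreePaths T

  private
    unique : ∀ l → Unique (P (c l))
    unique l = proj₁ (proj₂ (paths (c l)))

    linked : ∀ l → Linked Adj (P (c l))
    linked l = proj₂ (proj₂ (paths (c l)))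

  hole-edge-shares : ∀ {l l′} → CycSucc k l l′ → ShareEdge (P (c l)) (P (c l′))
  hole-edge-shares l→l′ = proj₂ (proj₁ (proj₂ hole) _ _ l→l′)

  hole-chordless : ∀ {l l′} → l ≢ l′ → ShareEdge (P (c l)) (P (c l′)) → CycAdj k l l′
  hole-chordless l≢l′ shared = proj₂ (proj₂ hole) _ _ (l≢l′ ∘ proj₁ hole , shared)

  no-edge-in-three-paths : ∀ {i j l a b} → CycSucc k i j → l ≢ i → l ≢ j →
                           PathEdge (P (c l)) a b → PathEdge (P (c i)) a b → ¬ PathEdge (P (c j)) a b
  no-edge-in-three-paths i→j l≢i l≢j ab∈l ab∈i ab∈j =
    no-common-neighbour 4≤k i→j (hole-chordless l≢i (_ , _ , ab∈l , ab∈i))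
                                (hole-chordless l≢j (_ , _ , ab∈l , ab∈j))

  hole-edge-splits : ∀ {i j} → CycSucc k i j → ¬ NonSplitting (P (c i)) (P (c j))
  hole-edge-splits {i} {j} i→j (shared , no-deg3) =
    no-shared-edge-behind-end (unique j) (linked j) vw∈B (sole-edge-at-departure no-deg3 uv∈A uv∉B vw∈B)
      (cycle-arc {G = Side} 3≤k propagate p→i i→j j→s pred-side) (hole-edge-shares j→s)
    where
    3≤k = <⇒≤ 4≤k
    p = proj₁ (cycPredecessor i)
    p→i = proj₂ (cycPredecessor i)
    j→s = proj₂ (cycSuccessor j)

    p≢i : p ≢ i
    p≢i p≡i = CycStep-irreflexive (<⇒≤ 3≤k) (subst (λ q → CycSucc k q i) p≡i p→i)
    p≢j : p ≢ j
    p≢j p≡j = CycStep-asymmetric 3≤k i→j (subst (λ q → CycSucc k q i) p≡j p→i)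

    ab∈p = proj₁ (proj₂ (proj₂ (hole-edge-shares p→i)))
    ab∈A = proj₂ (proj₂ (proj₂ (hole-edge-shares p→i)))
    ab∉B = no-edge-in-three-paths i→j p≢i p≢j ab∈p ab∈A
    open Departure (departure-from (unique i) (linked i) ab∈A ab∉B shared)

    Side : Fin k → Set
    Side l = OnSide v w (P (c l))

    avoids : ∀ {l} → l ≢ i → l ≢ j → ¬ PathEdge (P (c l)) v w
    avoids l≢i l≢j vw∈l = no-edge-in-three-paths i→j l≢i l≢j vw∈l vw∈A vw∈B

    pred-side : Side p
    pred-side = onSide (linked p) (avoids p≢i p≢j) (proj₁ (pathEdge-∈ ab∈p)) x↝v

    propagate : ∀ {l l′} → CycSucc k l′ l → l′ ≢ i → l′ ≢ j → Side l → Side l′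
    propagate l′→l l′≢i l′≢j l-side with hole-edge-shares l′→l
    ... | _ , _ , x∈l′ , x∈l =
      onSide (linked _) (avoids l′≢i l′≢j) (proj₁ (pathEdge-∈ x∈l′)) (l-side (proj₁ (pathEdge-∈ x∈l)))

lemma5 : {n m : ℕ} (T : Tree n) (P : Fin m → List (Fin n)) →
         (∀ i → NontrivialPath T (P i)) →
         (∀ i j → SamePath (P i) (P j) → i ≡ j) →
         (k : ℕ) → 4 ≤ k → (c : Fin k → Fin m) →
         IsHole (EPTAdj P) k c →
         ∀ i j → CycSucc k i j → ¬ ENPTAdj P (c i) (c j)
lemma5 T P paths _ k 4≤k c hole i j i→j (_ , nonsplitting) = hole-edge-splits T P paths 4≤k hole i→j nonsplitting
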